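{- Let $w = a_{i_1}\sqcup\!\sqcup_{\Theta}\dots\sqcup\!\sqcup_{\Theta} a_{i_n}$, $a_{i_1},\dots,a_{i_n} \in H_L$. Then the coefficient of the term in $L^{n+1}$ in $\phi(B_+^{a_r}(w))$ is equal to $\frac{1}{n+1}\phi(a_{i_1} \sqcup\!\sqcup_{\Theta}\dots \sqcup\!\sqcup_{\Theta} a_{i_n})$.
   Context: Let $H_W$ be the Hopf algebra of words over an alphabet $H_\Theta$ whose non-inherited letters form the set $H_L=\{a_1,\dots,a_R\}$, with quasi-shuffle product $\sqcup\!\sqcup_\Theta$ (defined by $w\sqcup\!\sqcup_\Theta\varnothing=w$ and $a_iu\sqcup\!\sqcup_\Theta a_jv=a_i(u\sqcup\!\sqcup_\Theta a_jv)+a_j(a_iu\sqcup\!\sqcup_\Theta v)+\Theta(a_i,a_j)(u\sqcup\!\sqcup_\Theta v)$, $\Theta$ a fully symmetric associative map combining letters), unit the empty word and deconcatenation coproduct $\Delta(w)=\sum_{uv=w}v\otimes u$. $B_+^{a_r}$ is the linear operator prepending the letter $a_r$ to each word. The Feynman rules are the character $\phi=\exp_\star(L\sigma):H_W\to\mathbb{C}[L]$, with $\sigma:H_W\to\mathbb C$ an infinitesimal character, $\star$ the convolution product, and $\sigma(a_i)=c_i\neq0$. -}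

module Defs where

open import Algebra.Bundles using (CommutativeRing)
open import Data.Nat using (ℕ; zero; suc)
open import Data.Fin using (Fin)
open import Data.List using (List; []; _∷_; _++_; map; foldr; concatMap)
open import Data.Vec using (Vec)
import Data.Vec as Vec
open import Data.Product using (_×_; _,_)

-- Hopf algebra of words H_W over an alphabet A (= H_Θ) with letter-combining map Θ,
-- coefficients in a commutative ring K (the paper uses ℂ).
module WordAlgebra {c ℓ} (K : CommutativeRing c ℓ) (A : Set) (Θ : A → A → A) where
  open CommutativeRing K

  Word : Set
  Word = List A

  -- an element of H_W as a formal linear combination  Σ k · w  (list of (k , w))
  Lin : Set c
  Lin = List (Carrier × Word)

  scale : Carrier → Lin → Lin
  scale k = map (λ { (l , w) → (k * l , w) })

  prefix : A → Lin → Lin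
  prefix x = map (λ { (l , w) → (l , x ∷ w) })

  B₊ : A → Lin → Lin
  B₊ = prefix

  unitL : Lin
  unitL = (1# , []) ∷ []

  qsh : Word → Word → Lin
  qsh [] v = (1# , v) ∷ []
  qsh (x ∷ u) [] = (1# , x ∷ u) ∷ []
  qsh (x ∷ u) (y ∷ v) =
    prefix x (qsh u (y ∷ v)) ++ (prefix y (qsh (x ∷ u) v) ++ prefix (Θ x y) (qsh u v))

  _⧢_ : Lin → Lin → Lin
  p ⧢ q = concatMap (λ { (k , u) → concatMap (λ { (l , v) → scale (k * l) (qsh u v) }) q }) p

  letter : A → Lin
  letter x = (1# , x ∷ []) ∷ []

  shuffleLetters : ∀ {R n} → (Fin R → A) → Vec (Fin R) n → Lin
  shuffleLetters a is = Vec.foldr _ (λ i acc → letter (a i) ⧢ acc) unitL is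

  linext : (Word → Carrier) → Lin → Carrier
  linext f = foldr (λ { (k , w) acc → k * f w + acc }) 0#

  ε : Word → Carrier
  ε [] = 1#
  ε (_ ∷ _) = 0#

  splittings : Word → List (Word × Word)
  splittings [] = ([] , []) ∷ []
  splittings (x ∷ w) = ([] , x ∷ w) ∷ map (λ { (u , v) → (x ∷ u , v) }) (splittings w)

  -- convolution with Δ(w) = Σ_{uv=w} v ⊗ u :  (f ⋆ g)(w) = Σ_{uv=w} f(v) g(u)
  _⋆_ : (Word → Carrier) → (Word → Carrier) → Word → Carrier
  (f ⋆ g) w = foldr (λ { (u , v) acc → f v * g u + acc }) 0# (splittings w)

  _^⋆_ : (Word → Carrier) → ℕ → Word → Carrier
  (f ^⋆ zero) = ε
  (f ^⋆ suc k) = f ⋆ (f ^⋆ k)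

  IsInfinitesimalCharacter : (Word → Carrier) → Set ℓ
  IsInfinitesimalCharacter σ =
    ∀ u v → linext σ (qsh u v) ≈ σ u * ε v + ε u * σ v

  fromℕ : ℕ → Carrier
  fromℕ zero = 0#
  fromℕ (suc n) = 1# + fromℕ n

  -- given inv n = 1/(n+1), the value 1/k!
  invFact : (ℕ → Carrier) → ℕ → Carrier
  invFact inv zero = 1#
  invFact inv (suc k) = inv k * invFact inv k

  -- φ = exp_⋆(L σ) = Σ_k L^k σ^{⋆k}/k! ; φCoef inv σ k w = coefficient of L^k in φ(w)
  φCoef : (ℕ → Carrier) → (Word → Carrier) → ℕ → Word → Carrier
  φCoef inv σ k w = invFact inv k * (σ ^⋆ k) w

module Submission where

-- The coefficient of L^k in φ = exp_⋆(Lσ) is σ^{⋆k}/k!.  The proof rests on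
-- two facts about words.
--   * Degree: a quasi-shuffle of n letters is a combination of words of
--     length at most n, since qsh u v only produces words of length at most
--     |u| + |v|  (qsh-degree, ⧢-degree, shuffleLetters-degree).
--   * Leading letter: for any f vanishing on the empty word (in particular an
--     infinitesimal character, σ-empty) and any word w with |w| ≤ k,
--       f^{⋆(k+1)}(x w) = f(x) · f^{⋆k}(w)          (^⋆-leading-letter),
--     because every splitting of x w with a nonempty right part starts with x.
-- Dividing by (k+1)! gives φCoef (n+1) (x w) = 1/(n+1) · σ(x) · φCoef n w for
-- |w| ≤ n (φCoef-leading-letter), and linearity of B₊ and linext
-- (linext-prefix) extends this from words to the quasi-shuffle a_{i_1} ⧢ … ⧢ a_{i_n}.

open import Defs
open import Algebra.Bundles using (CommutativeRing)
open import Data.Nat using (ℕ; zero; suc; _≤_; _<_; z≤n; s≤s) renaming (_+_ to _+ℕ_)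
import Data.Nat.Properties as ℕₚ
open import Data.Fin using (Fin)
open import Data.Vec using (Vec)
import Data.Vec as Vec
open import Data.List using (List; []; _∷_; length; map; concatMap; foldr)
open import Data.List.Relation.Unary.All using (All; []; _∷_)
import Data.List.Relation.Unary.All as All
open import Data.List.Relation.Unary.All.Properties using (map⁺; ++⁺; concat⁺)
open import Data.Product using (_×_; _,_; proj₁; proj₂)
open import Data.Sum using (_⊎_; inj₁; inj₂)
open import Function using (_∘_)
open import Relation.Binary.PropositionalEquality using (_≡_; _≢_; refl; cong)
import Relation.Binary.PropositionalEquality as ≡
open import Relation.Nullary using (¬_)
open import Function.Definitions using (Injective)
import Algebra.Properties.CommutativeSemigroup as CommutativeSemigroupProperties
import Algebra.Properties.Group as GroupProperties
import Algebra.Properties.Loop as LoopProperties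

All-concatMap : ∀ {a b p q} {X : Set a} {Y : Set b} {P : X → Set p} {Q : Y → Set q}
  (f : X → List Y) → (∀ {x} → P x → All Q (f x)) → ∀ {xs} → All P xs → All Q (concatMap f xs)
All-concatMap f h ps = concat⁺ (map⁺ (All.map h ps))

module TopCoefficient {c ℓ} (K : CommutativeRing c ℓ) (A : Set) (Θ : A → A → A) where
  open CommutativeRing K renaming (refl to ≈-refl)
  open WordAlgebra K A Θ
  open CommutativeSemigroupProperties *-commutativeSemigroup using (x∙yz≈y∙xz; interchange)
  open LoopProperties (GroupProperties.loop +-group) using (identityʳ-unique)
  open import Relation.Binary.Reasoning.Setoid setoid

  ∑ : ∀ {a} {X : Set a} → (X → Carrier) → List X → Carrier
  ∑ h [] = 0#
  ∑ h (p ∷ ps) = h p + ∑ h ps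

  foldr-∑ : ∀ {a} {X : Set a} {F : X → Carrier → Carrier} (h : X → Carrier)
    → (∀ p acc → F p acc ≡ h p + acc) → ∀ ps → foldr F 0# ps ≡ ∑ h ps
  foldr-∑ h F≡ [] = refl
  foldr-∑ h F≡ (p ∷ ps) = ≡.trans (F≡ p _) (cong (h p +_) (foldr-∑ h F≡ ps))

  ∑-map : ∀ {a b} {X : Set a} {Y : Set b} (h : Y → Carrier) (g : X → Y) ps
    → ∑ h (map g ps) ≡ ∑ (h ∘ g) ps
  ∑-map h g [] = refl
  ∑-map h g (p ∷ ps) = cong (h (g p) +_) (∑-map h g ps)

  ∑-cong : ∀ {a} {X : Set a} {h h′ : X → Carrier} {ps}
    → All (λ p → h p ≈ h′ p) ps → ∑ h ps ≈ ∑ h′ ps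
  ∑-cong [] = ≈-refl
  ∑-cong (e ∷ es) = +-cong e (∑-cong es)

  *-distribˡ-∑ : ∀ {a} {X : Set a} k (h : X → Carrier) ps
    → k * ∑ h ps ≈ ∑ (λ p → k * h p) ps
  *-distribˡ-∑ k h [] = zeroʳ k
  *-distribˡ-∑ k h (p ∷ ps) = trans (distribˡ k _ _) (+-congˡ (*-distribˡ-∑ k h ps))

  linext-∑ : ∀ f L → linext f L ≡ ∑ (λ t → proj₁ t * f (proj₂ t)) L
  linext-∑ f = foldr-∑ _ (λ _ _ → refl)

  ⋆-∑ : ∀ f g w → (f ⋆ g) w ≡ ∑ (λ s → f (proj₂ s) * g (proj₁ s)) (splittings w)
  ⋆-∑ f g w = foldr-∑ _ (λ _ _ → refl) (splittings w)

  ⋆-cons : ∀ f g x w → (f ⋆ g) (x ∷ w)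
    ≡ f (x ∷ w) * g [] + ∑ (λ s → f (proj₂ s) * g (x ∷ proj₁ s)) (splittings w)
  ⋆-cons f g x w = ≡.trans (⋆-∑ f g (x ∷ w))
    (cong (f (x ∷ w) * g [] +_) (∑-map (λ s → f (proj₂ s) * g (proj₁ s)) _ (splittings w)))

  SplitShape : Word → Word × Word → Set
  SplitShape w s = proj₂ s ≡ [] ⊎ length (proj₁ s) < length w

  splittings-shape : ∀ w → All (SplitShape w) (splittings w)
  splittings-shape [] = inj₁ refl ∷ []
  splittings-shape (x ∷ w) =
    inj₂ (s≤s z≤n) ∷ map⁺ {P = SplitShape (x ∷ w)} (All.map (λ {s} → lengthen {s}) (splittings-shape w))
    where
    lengthen : ∀ {s} → SplitShape w s → SplitShape (x ∷ w) (x ∷ proj₁ s , proj₂ s)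
    lengthen (inj₁ v≡[]) = inj₁ v≡[]
    lengthen (inj₂ u<w) = inj₂ (s≤s u<w)

  -- An infinitesimal character vanishes on the empty word: σ(∅) = σ(∅ ⧢ ∅) = 2σ(∅).
  σ-empty : ∀ σ → IsInfinitesimalCharacter σ → σ [] ≈ 0#
  σ-empty σ σ-inf = identityʳ-unique (σ []) (σ []) (sym doubled)
    where
    doubled : σ [] ≈ σ [] + σ []
    doubled = begin
      σ []                   ≈⟨ sym (*-identityˡ _) ⟩
      1# * σ []              ≈⟨ sym (+-identityʳ _) ⟩
      1# * σ [] + 0#         ≈⟨ σ-inf [] [] ⟩
      σ [] * 1# + 1# * σ []  ≈⟨ +-cong (*-identityʳ _) (*-identityˡ _) ⟩
      σ [] + σ []            ∎

  module LeadingLetter (f : Word → Carrier) (f-empty : f [] ≈ 0#) where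

    -- Powers f^{⋆(k+1)} vanish on the empty word, whose only splitting is (∅ , ∅).
    ^⋆-empty : ∀ k → (f ^⋆ suc k) [] ≈ 0#
    ^⋆-empty k = begin
      f [] * (f ^⋆ k) [] + 0#  ≈⟨ +-identityʳ _ ⟩
      f [] * (f ^⋆ k) []       ≈⟨ *-congʳ f-empty ⟩
      0# * (f ^⋆ k) []         ≈⟨ zeroˡ _ ⟩
      0#                       ∎

    killed : ∀ a b → a * (f [] * b) ≈ 0#
    killed a b = trans (*-congˡ (trans (*-congʳ f-empty) (zeroˡ b))) (zeroʳ a)

    ^⋆-leading-letter : ∀ k x w → length w ≤ k → (f ^⋆ suc k) (x ∷ w) ≈ f (x ∷ []) * (f ^⋆ k) w
    ^⋆-leading-letter zero x [] z≤n =
      trans (+-congˡ (trans (+-identityʳ _) (zeroʳ _))) (+-identityʳ _)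
    ^⋆-leading-letter (suc k) x w |w|≤1+k = begin
      (f ^⋆ suc (suc k)) (x ∷ w)
        ≡⟨ ⋆-cons f (f ^⋆ suc k) x w ⟩
      f (x ∷ w) * (f ^⋆ suc k) [] + ∑ (λ s → f (proj₂ s) * (f ^⋆ suc k) (x ∷ proj₁ s)) (splittings w)
        ≈⟨ +-cong (trans (*-congˡ (^⋆-empty k)) (zeroʳ _)) (∑-cong (All.map split-off (splittings-shape w))) ⟩
      0# + ∑ (λ s → f (x ∷ []) * (f (proj₂ s) * (f ^⋆ k) (proj₁ s))) (splittings w)
        ≈⟨ +-identityˡ _ ⟩
      ∑ (λ s → f (x ∷ []) * (f (proj₂ s) * (f ^⋆ k) (proj₁ s))) (splittings w)
        ≈⟨ sym (*-distribˡ-∑ _ _ (splittings w)) ⟩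
      f (x ∷ []) * ∑ (λ s → f (proj₂ s) * (f ^⋆ k) (proj₁ s)) (splittings w)
        ≡⟨ cong (f (x ∷ []) *_) (≡.sym (⋆-∑ f (f ^⋆ k) w)) ⟩
      f (x ∷ []) * (f ^⋆ suc k) w ∎
      where
      -- termwise: empty right parts contribute 0 on both sides, otherwise induct
      split-off : ∀ {s} → SplitShape w s
        → f (proj₂ s) * (f ^⋆ suc k) (x ∷ proj₁ s) ≈ f (x ∷ []) * (f (proj₂ s) * (f ^⋆ k) (proj₁ s))
      split-off {u , .[]} (inj₁ refl) =
        trans (trans (*-congʳ f-empty) (zeroˡ _)) (sym (killed _ _))
      split-off {u , v} (inj₂ |u|<|w|) = begin
        f v * (f ^⋆ suc k) (x ∷ u)         ≈⟨ *-congˡ (^⋆-leading-letter k x u (ℕₚ.≤-pred (ℕₚ.≤-trans |u|<|w| |w|≤1+k))) ⟩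
        f v * (f (x ∷ []) * (f ^⋆ k) u)    ≈⟨ x∙yz≈y∙xz _ _ _ ⟩
        f (x ∷ []) * (f v * (f ^⋆ k) u)    ∎

  φCoef-leading-letter : ∀ inv σ → IsInfinitesimalCharacter σ → ∀ n x w → length w ≤ n
    → φCoef inv σ (suc n) (x ∷ w) ≈ (inv n * σ (x ∷ [])) * φCoef inv σ n w
  φCoef-leading-letter inv σ σ-inf n x w |w|≤n = begin
    (inv n * invFact inv n) * (σ ^⋆ suc n) (x ∷ w)       ≈⟨ *-congˡ (^⋆-leading-letter n x w |w|≤n) ⟩
    (inv n * invFact inv n) * (σ (x ∷ []) * (σ ^⋆ n) w)  ≈⟨ interchange _ _ _ _ ⟩
    (inv n * σ (x ∷ [])) * (invFact inv n * (σ ^⋆ n) w)  ∎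
    where open LeadingLetter σ (σ-empty σ σ-inf)

  linext-prefix : ∀ f g k x L → All (λ t → f (x ∷ proj₂ t) ≈ k * g (proj₂ t)) L
    → linext f (prefix x L) ≈ k * linext g L
  linext-prefix f g k x L f≈kg = begin
    linext f (prefix x L)                        ≡⟨ linext-∑ f (prefix x L) ⟩
    ∑ (λ t → proj₁ t * f (proj₂ t)) (prefix x L)  ≡⟨ ∑-map _ _ L ⟩
    ∑ (λ t → proj₁ t * f (x ∷ proj₂ t)) L         ≈⟨ ∑-cong (All.map (λ e → trans (*-congˡ e) (x∙yz≈y∙xz _ _ _)) f≈kg) ⟩
    ∑ (λ t → k * (proj₁ t * g (proj₂ t))) L       ≈⟨ sym (*-distribˡ-∑ k _ L) ⟩
    k * ∑ (λ t → proj₁ t * g (proj₂ t)) L         ≡⟨ cong (k *_) (≡.sym (linext-∑ g L)) ⟩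
    k * linext g L                                ∎

  DegreeAtMost : ℕ → Lin → Set c
  DegreeAtMost m = All (λ t → length (proj₂ t) ≤ m)

  degree-weaken : ∀ {m m′} → m ≤ m′ → ∀ {L} → DegreeAtMost m L → DegreeAtMost m′ L
  degree-weaken m≤m′ = All.map (λ |w|≤m → ℕₚ.≤-trans |w|≤m m≤m′)

  prefix-degree : ∀ {m} x {L} → DegreeAtMost m L → DegreeAtMost (suc m) (prefix x L)
  prefix-degree x d = map⁺ (All.map s≤s d)

  scale-degree : ∀ {m} k {L} → DegreeAtMost m L → DegreeAtMost m (scale k L)
  scale-degree k d = map⁺ d

  qsh-degree : ∀ u v → DegreeAtMost (length u +ℕ length v) (qsh u v)
  qsh-degree [] v = ℕₚ.≤-refl ∷ []
  qsh-degree (x ∷ u) [] = ℕₚ.≤-reflexive (≡.sym (ℕₚ.+-identityʳ _)) ∷ []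
  qsh-degree (x ∷ u) (y ∷ v) =
    ++⁺ (prefix-degree x (qsh-degree u (y ∷ v)))
        (++⁺ (degree-weaken (ℕₚ.≤-reflexive (cong suc (≡.sym (ℕₚ.+-suc (length u) (length v)))))
                            (prefix-degree y (qsh-degree (x ∷ u) v)))
             (degree-weaken (s≤s (ℕₚ.+-monoʳ-≤ (length u) (ℕₚ.n≤1+n (length v))))
                            (prefix-degree (Θ x y) (qsh-degree u v))))

  ⧢-degree : ∀ {m m′ p q} → DegreeAtMost m p → DegreeAtMost m′ q → DegreeAtMost (m +ℕ m′) (p ⧢ q)
  ⧢-degree dp dq =
    All-concatMap _ (λ {(k , u)} |u|≤m →
      All-concatMap _ (λ {(l , v)} |v|≤m′ →
        scale-degree (k * l) (degree-weaken (ℕₚ.+-mono-≤ |u|≤m |v|≤m′) (qsh-degree u v))) dq) dp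

  shuffleLetters-degree : ∀ {R n} (a : Fin R → A) (is : Vec (Fin R) n)
    → DegreeAtMost n (shuffleLetters a is)
  shuffleLetters-degree a Vec.[] = z≤n ∷ []
  shuffleLetters-degree a (i Vec.∷ is) = ⧢-degree (ℕₚ.≤-refl ∷ []) (shuffleLetters-degree a is)

proposition11 : ∀ {c ℓ} (K : CommutativeRing c ℓ) (A : Set) (Θ : A → A → A)
    → (∀ x y → Θ x y ≡ Θ y x)
    → (∀ x y z → Θ (Θ x y) z ≡ Θ x (Θ y z))
    → (R : ℕ) (a : Fin R → A)
    → Injective _≡_ _≡_ a
    → (∀ i x y → Θ x y ≢ a i)
    → let open CommutativeRing K
          open WordAlgebra K A Θ
      in (inv : ℕ → Carrier)
    → (∀ n → fromℕ (suc n) * inv n ≈ 1#)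
    → (σ : Word → Carrier)
    → IsInfinitesimalCharacter σ
    → (cs : Fin R → Carrier)
    → (∀ i → σ (a i ∷ []) ≈ cs i)
    → (∀ i → ¬ (cs i ≈ 0#))
    → (n : ℕ) (is : Vec (Fin R) n) (r : Fin R)
    → linext (φCoef inv σ (suc n)) (B₊ (a r) (shuffleLetters a is))
      ≈ inv n * (cs r * linext (φCoef inv σ n) (shuffleLetters a is))
proposition11 K A Θ _ _ R a _ _ inv _ σ σ-inf cs σ-letter _ n is r = begin
  linext (φCoef inv σ (suc n)) (B₊ (a r) w)
    ≈⟨ linext-prefix _ _ _ (a r) w
         (All.map (φCoef-leading-letter inv σ σ-inf n (a r) _) (shuffleLetters-degree a is)) ⟩
  (inv n * σ (a r ∷ [])) * linext (φCoef inv σ n) w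
    ≈⟨ *-assoc _ _ _ ⟩
  inv n * (σ (a r ∷ []) * linext (φCoef inv σ n) w)
    ≈⟨ *-congˡ (*-congʳ (σ-letter r)) ⟩
  inv n * (cs r * linext (φCoef inv σ n) w) ∎
  where
  open CommutativeRing K
  open WordAlgebra K A Θ
  open TopCoefficient K A Θ
  open import Relation.Binary.Reasoning.Setoid setoid
  w : Lin
  w = shuffleLetters a is
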